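{- Let $G$ be a DAG and $\mathrm{lxt}(G)$ its leaf-extended DAG. Then $\mathrm{sf}(G)\simeq \mathrm{lop}(\mathscr{H}(\mathfrak{C}_{\mathrm{lxt}(G)},\subseteq))$. Equivalently, $G$ is isomorphic to a DAG obtained from $\mathrm{lop}(\mathscr{H}(\mathfrak{C}_{\mathrm{lxt}(G)},\subseteq))$ by adding a (possibly empty) set of shortcuts.
   Context: A DAG is a finite directed graph without loops and directed cycles; $u\prec_G v$ means there is a directed path of positive length from $v$ to $u$, and $u\preceq_G v$ allows $u=v$. $L(G)$ is the set of $\preceq_G$-minimal vertices (leaves), other vertices are inner. $C_G(v)=\{x\in L(G):x\preceq_G v\}$, $\mathfrak{C}_G=\{C_G(v):v\in V(G)\}$. The leaf-extended DAG $\mathrm{lxt}(G)$ is obtained from $G$ by adding, for every inner vertex $v$, a new vertex $x_v$ and the edge $(v,x_v)$. An edge $(u,w)$ is a shortcut if there is $v$ with $w\prec_G v\prec_G u$; $\mathrm{sf}(G)$ is $G$ with all shortcuts removed. For a set system $\mathfrak{C}$, the Hasse diagram $\mathscr{H}(\mathfrak{C},\subseteq)$ is the DAG on vertex set $\mathfrak{C}$ with an edge from $A$ to $B$ iff $B\subsetneq A$ and no $C\in\mathfrak{C}$ satisfies $B\subsetneq C\subsetneq A$. A DAG is tree-leaf-child if every inner vertex has a child that is a leaf of in-degree one. For a tree-leaf-child DAG $H$, $\mathrm{lop}(H)$ denotes a DAG obtained from $H$ by removing, for each inner vertex $v$ of $H$, exactly one leaf-child of $v$ with in-degree one; this is well-defined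 up to isomorphism (and $\mathscr{H}(\mathfrak{C}_{\mathrm{lxt}(G)},\subseteq)$ is tree-leaf-child). $\simeq$ denotes isomorphism of directed graphs. -}

module Defs where

open import Data.Nat using (ℕ)
open import Data.Fin using (Fin)
open import Data.Bool using (Bool; T)
open import Data.Empty using (⊥)
open import Data.Product using (Σ; ∃; _×_; _,_; proj₁)
open import Data.Sum using (_⊎_; inj₁; inj₂)
open import Relation.Nullary using (¬_)
open import Relation.Binary.PropositionalEquality using (_≡_)

-- Directed graphs whose vertex set is given as a setoid (vertices are
-- equivalence classes of elements of V under _≈_).  This is needed because
-- the vertex set of a Hasse diagram is a set system, i.e. a collection of
-- sets identified up to extensional equality.

record Graph : Set₁ where
  field
    V   : Set
    _≈_ : V → V → Set
    E   : V → V → Set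

module _ (G : Graph) where
  open Graph G

  data Path : V → V → Set where
    one  : ∀ {v u} → E v u → Path v u
    step : ∀ {v w u} → E v w → Path w u → Path v u

  _≺_ : V → V → Set
  u ≺ v = Path v u

  _⪯_ : V → V → Set
  u ⪯ v = (u ≈ v) ⊎ (u ≺ v)

  Leaf : V → Set
  Leaf v = ¬ (∃ λ u → u ≺ v)

  Inner : V → Set
  Inner v = ¬ Leaf v

  Acyclic : Set
  Acyclic = ∀ v → ¬ Path v v

  Cl : V → V → Set
  Cl v x = Leaf x × (x ⪯ v)

  Shortcut : V → V → Set
  Shortcut u w = E u w × ∃ λ v → (w ≺ v) × (v ≺ u)

  sf : Graph
  sf = record { V = V ; _≈_ = _≈_ ; E = λ u w → E u w × ¬ Shortcut u w }

  InDegOne : V → Set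
  InDegOne c = ∃ λ p → E p c × (∀ q → E q c → q ≈ p)

  record LopChoice : Set where
    field
      ch       : (v : V) → Inner v → V
      ch-child : ∀ v i → E v (ch v i)
      ch-leaf  : ∀ v i → Leaf (ch v i)
      ch-indeg : ∀ v i → InDegOne (ch v i)
      ch-resp  : ∀ v v' i i' → v ≈ v' → ch v i ≈ ch v' i'

  lop : LopChoice → Graph
  lop c = record
    { V   = Σ V (λ w → ¬ Removed w)
    ; _≈_ = λ a b → proj₁ a ≈ proj₁ b
    ; E   = λ a b → E (proj₁ a) (proj₁ b)
    }
    where
      open LopChoice c
      Removed : V → Set
      Removed w = ∃ λ v → Σ (Inner v) λ i → w ≈ ch v i

record _≃_ (G H : Graph) : Set where
  module G = Graph G
  module H = Graph H
  field
    f      : G.V → H.V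
    resp   : ∀ {u w} → u G.≈ w → f u H.≈ f w
    inj    : ∀ {u w} → f u H.≈ f w → u G.≈ w
    surj   : ∀ y → ∃ λ x → f x H.≈ y
    edge→  : ∀ {u w} → G.E u w → H.E (f u) (f w)
    edge←  : ∀ {u w} → H.E (f u) (f w) → G.E u w

finGraph : (n : ℕ) → (Fin n → Fin n → Bool) → Graph
finGraph n adj = record { V = Fin n ; _≈_ = _≡_ ; E = λ u w → T (adj u w) }

-- leaf-extended DAG lxt(G): add x_v and edge (v , x_v) for each inner v
lxt : Graph → Graph
lxt G = record { V = LV ; _≈_ = Eq ; E = LE }
  where
    open Graph G
    LV : Set
    LV = V ⊎ Σ V (Inner G)
    Eq : LV → LV → Set
    Eq (inj₁ a) (inj₁ b) = a ≈ b
    Eq (inj₁ a) (inj₂ b) = ⊥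
    Eq (inj₂ a) (inj₁ b) = ⊥
    Eq (inj₂ (a , _)) (inj₂ (b , _)) = a ≈ b
    LE : LV → LV → Set
    LE (inj₁ u) (inj₁ w) = E u w
    LE (inj₁ u) (inj₂ (w , _)) = u ≈ w
    LE (inj₂ _) _ = ⊥

-- Vertices are clusters, represented by vertices
-- v of G and identified when C_G(u) = C_G(v) (extensionally).

module _ (G : Graph) where
  open Graph G

  _⊆C_ : V → V → Set
  u ⊆C w = ∀ x → Cl G u x → Cl G w x

  _⊊C_ : V → V → Set
  u ⊊C w = (u ⊆C w) × ¬ (w ⊆C u)

  HasseC : Graph
  HasseC = record
    { V   = V
    ; _≈_ = λ u w → (u ⊆C w) × (w ⊆C u)
    ; E   = λ a b → (b ⊊C a) × ¬ (∃ λ c → (b ⊊C c) × (c ⊊C a))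
    }

{-# OPTIONS --safe #-}
-- In lxt(G) every vertex a of G has a leaf of its own below it: a itself if a is a leaf of G,
-- the new leaf x_a otherwise.  Hence C(a) ⊆ C(b) iff a ⪯ b, so a ↦ C(a) embeds (V(G), ⪯)
-- into the cluster system, whose only other members are the singletons {x_a}.  The covering
-- pairs of ⪯ are exactly the edges of sf(G), so the Hasse diagram is sf(G) with a pendant leaf
-- x_a attached to each inner a, and removing these leaves gives back sf(G).  Removing any
-- other admissible choice of leaves gives an isomorphic graph: two chosen leaves of in-degree
-- one with the same parent can be swapped.
module Submission where

open import Defs
open import Data.Nat using (ℕ)
open import Data.Fin using (Fin; _≟_)
open import Data.Fin.Properties using (any?)
open import Data.Bool using (Bool; T)
open import Data.Empty using (⊥-elim)
open import Data.Product using (Σ; ∃; _×_; _,_; proj₁; proj₂)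
open import Data.Sum using (inj₁; inj₂)
open import Relation.Nullary using (¬_; Dec; yes; no)
open import Relation.Nullary.Decidable using (T?; ¬?; map′; decidable-stable; toSum)
open import Relation.Binary.Definitions using (Transitive)
open import Relation.Binary.Structures using (IsEquivalence)
open import Relation.Binary.PropositionalEquality using (_≡_; refl; sym; trans)

module _ {K : Graph} where
  open Graph K

  infixr 5 _++ᵖ_
  _++ᵖ_ : ∀ {a b c} → Path K a b → Path K b c → Path K a c
  one e    ++ᵖ q = step e q
  step e p ++ᵖ q = step e (p ++ᵖ q)

  head-edge : ∀ {a b} → Path K a b → ∃ (E a)
  head-edge (one e)    = _ , e
  head-edge (step e _) = _ , e

  no-child⇒leaf : ∀ {a} → ¬ ∃ (E a) → Leaf K a
  no-child⇒leaf no-child (_ , p) = no-child (head-edge p)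

  Cl-of-leaf : ∀ {z y} → Leaf K z → Cl K z y → y ≈ z
  Cl-of-leaf _      (_ , inj₁ y≈z) = y≈z
  Cl-of-leaf z-leaf (_ , inj₂ z→y) = ⊥-elim (z-leaf (_ , z→y))

module _ (K : Graph) where
  open Graph K

  Covers : V → V → Set
  Covers u w = Path K u w × ¬ (∃ λ v → Path K v w × Path K u v)

  sf-edge⇒covers : ∀ {u w} → E u w × ¬ Shortcut K u w → Covers u w
  sf-edge⇒covers (e , no-shortcut) = one e , λ between → no-shortcut (e , between)

  covers⇒sf-edge : ∀ {u w} → Covers u w → E u w × ¬ Shortcut K u w
  covers⇒sf-edge (one e , no-between) = e , λ (_ , between) → no-between between
  covers⇒sf-edge (step e p , no-between) = ⊥-elim (no-between (_ , p , one e))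

≃-trans : ∀ {A B C} → Transitive (Graph._≈_ C) → A ≃ B → B ≃ C → A ≃ C
≃-trans {C = C} ≈-trans φ ψ = record
  { f     = λ x → Ψ.f (Φ.f x)
  ; resp  = λ x≈y → Ψ.resp (Φ.resp x≈y)
  ; inj   = λ fx≈fy → Φ.inj (Ψ.inj fx≈fy)
  ; surj  = surj
  ; edge→ = λ e → Ψ.edge→ (Φ.edge→ e)
  ; edge← = λ e → Φ.edge← (Ψ.edge← e)
  }
  where
    module Φ = _≃_ φ
    module Ψ = _≃_ ψ
    surj : ∀ z → ∃ λ x → Graph._≈_ C (Ψ.f (Φ.f x)) z
    surj z with Ψ.surj z
    ... | y , fy≈z with Φ.surj y
    ...   | x , fx≈y = x , ≈-trans (Ψ.resp fx≈y) fy≈z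

module _ (K : Graph) where
  private
    _⊆_ _⊊_ _≈ᴴ_ Eᴴ : Graph.V K → Graph.V K → Set
    _⊆_ = _⊆C_ K
    _⊊_ = _⊊C_ K
    _≈ᴴ_ = Graph._≈_ (HasseC K)
    Eᴴ = Graph.E (HasseC K)

  ⊆C-refl : ∀ {u} → u ⊆ u
  ⊆C-refl _ x∈u = x∈u

  ⊆C-trans : ∀ {u v w} → u ⊆ v → v ⊆ w → u ⊆ w
  ⊆C-trans u⊆v v⊆w x x∈u = v⊆w x (u⊆v x x∈u)

  ≈ᴴ-refl : ∀ {u} → u ≈ᴴ u
  ≈ᴴ-refl = ⊆C-refl , ⊆C-refl

  ≈ᴴ-sym : ∀ {u v} → u ≈ᴴ v → v ≈ᴴ u
  ≈ᴴ-sym (u⊆v , v⊆u) = v⊆u , u⊆v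

  ≈ᴴ-trans : ∀ {u v w} → u ≈ᴴ v → v ≈ᴴ w → u ≈ᴴ w
  ≈ᴴ-trans (u⊆v , v⊆u) (v⊆w , w⊆v) = ⊆C-trans u⊆v v⊆w , ⊆C-trans w⊆v v⊆u

  ≈ᴴ-isEquivalence : IsEquivalence _≈ᴴ_
  ≈ᴴ-isEquivalence = record { refl = ≈ᴴ-refl ; sym = ≈ᴴ-sym ; trans = ≈ᴴ-trans }

  ⊊C-resp : ∀ {u u′ w w′} → u ≈ᴴ u′ → w ≈ᴴ w′ → u ⊊ w → u′ ⊊ w′
  ⊊C-resp (_ , u′⊆u) (w⊆w′ , _) (u⊆w , w⊈u) =
    ⊆C-trans u′⊆u (⊆C-trans u⊆w w⊆w′) ,
    λ w′⊆u′ → w⊈u (⊆C-trans w⊆w′ (⊆C-trans w′⊆u′ u′⊆u))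

  Eᴴ-resp : ∀ {u u′ w w′} → u ≈ᴴ u′ → w ≈ᴴ w′ → Eᴴ u w → Eᴴ u′ w′
  Eᴴ-resp u≈u′ w≈w′ (w⊊u , no-between) =
    ⊊C-resp w≈w′ u≈u′ w⊊u ,
    λ (c , w′⊊c , c⊊u′) →
      no-between (c , ⊊C-resp (≈ᴴ-sym w≈w′) ≈ᴴ-refl w′⊊c , ⊊C-resp ≈ᴴ-refl (≈ᴴ-sym u≈u′) c⊊u′)

module SetoidGraph (K : Graph)
  (isEquivalence : IsEquivalence (Graph._≈_ K))
  (E-resp : ∀ {a a′ b b′} → Graph._≈_ K a a′ → Graph._≈_ K b b′ → Graph.E K a b → Graph.E K a′ b′)
  where
  open Graph K
  open IsEquivalence isEquivalence renaming (refl to ≈-refl; sym to ≈-sym; trans to ≈-trans)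

  Leaf-resp : ∀ {a a′} → a ≈ a′ → Leaf K a → Leaf K a′
  Leaf-resp a≈a′ a-leaf (_ , p) with head-edge p
  ... | x , e = a-leaf (x , one (E-resp (≈-sym a≈a′) ≈-refl e))

  Chosen : LopChoice K → V → Set
  Chosen c w = ∃ λ v → Σ (Inner K v) λ i → w ≈ LopChoice.ch c v i

  Chosen-resp : ∀ c {w w′} → w ≈ w′ → Chosen c w → Chosen c w′
  Chosen-resp c w≈w′ (v , i , w≈) = v , i , ≈-trans (≈-sym w≈w′) w≈

  module _ (c : LopChoice K) where
    open LopChoice c

    parent-of-chosen : ∀ {p v i w} → w ≈ ch v i → E p w → p ≈ v
    parent-of-chosen {p} {v} {i} w≈ e with ch-indeg v i
    ... | _ , _ , unique = ≈-trans (unique p (E-resp ≈-refl w≈ e)) (≈-sym (unique v (ch-child v i)))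

    chosen-leaf : ∀ {v i w} → w ≈ ch v i → Leaf K w
    chosen-leaf w≈ = Leaf-resp (≈-sym w≈) (ch-leaf _ _)

    source-unchosen : ∀ {w y} → E w y → ¬ Chosen c w
    source-unchosen e (_ , _ , w≈) = chosen-leaf w≈ (_ , one e)

  module _ (c c′ : LopChoice K) where
    private
      module C  = LopChoice c
      module C′ = LopChoice c′

    chosen-twice⇒same-parent : ∀ {v i v′ i′} → C.ch v i ≈ C′.ch v′ i′ → v ≈ v′
    chosen-twice⇒same-parent eq = parent-of-chosen c′ eq (C.ch-child _ _)

    swapped-unchosen : ∀ {v i w} → w ≈ C′.ch v i → ¬ Chosen c w → ¬ Chosen c′ (C.ch v i)
    swapped-unchosen {v} {i} w≈ w∉c (v′ , i′ , eq) =
      w∉c (v , i , ≈-trans w≈ (≈-trans (C′.ch-resp v v′ i i′ (chosen-twice⇒same-parent eq)) (≈-sym eq)))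

  module _ (chosen? : ∀ c w → Dec (Chosen c w)) (c c′ : LopChoice K) where
    private
      module C  = LopChoice c
      module C′ = LopChoice c′

    swap : Graph.V (lop K c) → Graph.V (lop K c′)
    swap (w , w∉c) with chosen? c′ w
    ... | yes (v , i , w≈) = C.ch v i , swapped-unchosen c c′ w≈ w∉c
    ... | no w∉c′          = w , w∉c′

    swap-chosen : ∀ {w v i} (w∉c : ¬ Chosen c w) → w ≈ C′.ch v i → proj₁ (swap (w , w∉c)) ≈ C.ch v i
    swap-chosen {w} {v} {i} w∉c w≈ with chosen? c′ w
    ... | yes (v′ , i′ , w≈′) =
      C.ch-resp v′ v i′ i (chosen-twice⇒same-parent c′ c′ (≈-trans (≈-sym w≈′) w≈))
    ... | no w∉c′ = ⊥-elim (w∉c′ (v , i , w≈))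

    swap-unchosen : ∀ {w} (w∉c : ¬ Chosen c w) → ¬ Chosen c′ w → proj₁ (swap (w , w∉c)) ≈ w
    swap-unchosen {w} w∉c w∉c′ with chosen? c′ w
    ... | yes w∈c′ = ⊥-elim (w∉c′ w∈c′)
    ... | no _     = ≈-refl

    swap-fixes-source : ∀ {w y} (w∉c : ¬ Chosen c w) → E w y → proj₁ (swap (w , w∉c)) ≈ w
    swap-fixes-source w∉c e = swap-unchosen w∉c (source-unchosen c′ e)

    swap-fixes-source′ : ∀ {w y} (w∉c : ¬ Chosen c w) →
                         E (proj₁ (swap (w , w∉c))) y → proj₁ (swap (w , w∉c)) ≈ w
    swap-fixes-source′ w∉c e =
      swap-unchosen w∉c λ (v , i , w≈) → source-unchosen c e (v , i , swap-chosen w∉c w≈)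

    -- Case splits use toSum (chosen? c′ w): a `with` on chosen? c′ w itself would abstract
    -- the decision inside swap, and swap-chosen / swap-unchosen would no longer apply.
    lop-unique : lop K c ≃ lop K c′
    lop-unique = record
      { f = swap ; resp = resp ; inj = inj ; surj = surj ; edge→ = edge→ ; edge← = edge← }
      where
        resp : ∀ {x y} → proj₁ x ≈ proj₁ y → proj₁ (swap x) ≈ proj₁ (swap y)
        resp {w , w∉c} {w′ , w′∉c} w≈w′ with toSum (chosen? c′ w)
        ... | inj₁ (v , i , w≈) =
          ≈-trans (swap-chosen w∉c w≈) (≈-sym (swap-chosen w′∉c (≈-trans (≈-sym w≈w′) w≈)))
        ... | inj₂ w∉c′ =
          ≈-trans (swap-unchosen w∉c w∉c′) (≈-trans w≈w′ (≈-sym (swap-unchosen w′∉c w′∉c′)))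
          where
            w′∉c′ : ¬ Chosen c′ w′
            w′∉c′ w′∈c′ = w∉c′ (Chosen-resp c′ (≈-sym w≈w′) w′∈c′)

        inj : ∀ {x y} → proj₁ (swap x) ≈ proj₁ (swap y) → proj₁ x ≈ proj₁ y
        inj {w , w∉c} {w′ , w′∉c} eq with toSum (chosen? c′ w) | toSum (chosen? c′ w′)
        ... | inj₁ (v , i , w≈) | inj₁ (v′ , i′ , w′≈) =
          ≈-trans w≈ (≈-trans (C′.ch-resp v v′ i i′ (chosen-twice⇒same-parent c c chosen≈)) (≈-sym w′≈))
          where
            chosen≈ : C.ch v i ≈ C.ch v′ i′
            chosen≈ = ≈-trans (≈-sym (swap-chosen w∉c w≈)) (≈-trans eq (swap-chosen w′∉c w′≈))
        ... | inj₁ (v , i , w≈) | inj₂ w′∉c′ =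
          ⊥-elim (w′∉c (v , i , ≈-trans (≈-sym (swap-unchosen w′∉c w′∉c′))
                                   (≈-trans (≈-sym eq) (swap-chosen w∉c w≈))))
        ... | inj₂ w∉c′ | inj₁ (v′ , i′ , w′≈) =
          ⊥-elim (w∉c (v′ , i′ , ≈-trans (≈-sym (swap-unchosen w∉c w∉c′))
                                    (≈-trans eq (swap-chosen w′∉c w′≈))))
        ... | inj₂ w∉c′ | inj₂ w′∉c′ =
          ≈-trans (≈-sym (swap-unchosen w∉c w∉c′)) (≈-trans eq (swap-unchosen w′∉c w′∉c′))

        surj : ∀ y → ∃ λ x → proj₁ (swap x) ≈ proj₁ y
        surj (y , y∉c′) with toSum (chosen? c y)
        ... | inj₁ (v , i , y≈) =
          (C′.ch v i , swapped-unchosen c′ c y≈ y∉c′) ,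
          ≈-trans (swap-chosen (swapped-unchosen c′ c y≈ y∉c′) ≈-refl) (≈-sym y≈)
        ... | inj₂ y∉c = (y , y∉c) , swap-unchosen y∉c y∉c′

        edge→ : ∀ {x y} → E (proj₁ x) (proj₁ y) → E (proj₁ (swap x)) (proj₁ (swap y))
        edge→ {w , w∉c} {w′ , w′∉c} e with toSum (chosen? c′ w′)
        ... | inj₁ (v , i , w′≈) =
          E-resp (≈-sym (≈-trans (swap-fixes-source w∉c e) (parent-of-chosen c′ w′≈ e)))
                 (≈-sym (swap-chosen w′∉c w′≈)) (C.ch-child v i)
        ... | inj₂ w′∉c′ =
          E-resp (≈-sym (swap-fixes-source w∉c e)) (≈-sym (swap-unchosen w′∉c w′∉c′)) e

        edge← : ∀ {x y} → E (proj₁ (swap x)) (proj₁ (swap y)) → E (proj₁ x) (proj₁ y)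
        edge← {w , w∉c} {w′ , w′∉c} e with toSum (chosen? c′ w′)
        ... | inj₁ (v , i , w′≈) =
          E-resp (≈-trans (≈-sym (parent-of-chosen c (swap-chosen w′∉c w′≈) e))
                          (swap-fixes-source′ w∉c e))
                 (≈-sym w′≈) (C′.ch-child v i)
        ... | inj₂ w′∉c′ = E-resp (swap-fixes-source′ w∉c e) (swap-unchosen w′∉c w′∉c′) e

module LeafExtension {V : Set} (E : V → V → Set) where
  G : Graph
  G = record { V = V ; _≈_ = _≡_ ; E = E }

  L : Graph
  L = lxt G

  V⁺ : Set
  V⁺ = Graph.V L

  _≈⁺_ _⪯ᴸ_ _⊆_ : V⁺ → V⁺ → Set
  _≈⁺_ = Graph._≈_ L
  _⪯ᴸ_ = _⪯_ L
  _⊆_  = _⊆C_ L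

  _⪯ᴳ_ : V → V → Set
  _⪯ᴳ_ = _⪯_ G

  ≈⁺-sym : ∀ {x y} → x ≈⁺ y → y ≈⁺ x
  ≈⁺-sym {inj₁ _} {inj₁ _} = sym
  ≈⁺-sym {inj₂ _} {inj₂ _} = sym

  ≈⁺-trans : ∀ {x y z} → x ≈⁺ y → y ≈⁺ z → x ≈⁺ z
  ≈⁺-trans {inj₁ _} {inj₁ _} {inj₁ _} = trans
  ≈⁺-trans {inj₂ _} {inj₂ _} {inj₂ _} = trans

  new-leaf-no-path : ∀ {x y} → ¬ Path L (inj₂ x) y
  new-leaf-no-path (one ())
  new-leaf-no-path (step () _)

  new-leaf-is-leaf : ∀ {x} → Leaf L (inj₂ x)
  new-leaf-is-leaf (_ , p) = new-leaf-no-path p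

  path-lxt⇒path : ∀ {a b} → Path L (inj₁ a) (inj₁ b) → Path G a b
  path-lxt⇒path (one e)                  = one e
  path-lxt⇒path (step {w = inj₁ _} e p) = step e (path-lxt⇒path p)
  path-lxt⇒path (step {w = inj₂ _} e p) = ⊥-elim (new-leaf-no-path p)

  path⇒path-lxt : ∀ {a b} → Path G a b → Path L (inj₁ a) (inj₁ b)
  path⇒path-lxt (one e)    = one e
  path⇒path-lxt (step e p) = step e (path⇒path-lxt p)

  path-to-new-leaf⇒⪯ : ∀ {a b p} → Path L (inj₁ a) (inj₂ (b , p)) → b ⪯ᴳ a
  path-to-new-leaf⇒⪯ (one a≡b) = inj₁ (sym a≡b)
  path-to-new-leaf⇒⪯ (step {w = inj₂ _} e q) = ⊥-elim (new-leaf-no-path q)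
  path-to-new-leaf⇒⪯ (step {w = inj₁ _} e q) with path-to-new-leaf⇒⪯ q
  ... | inj₁ refl = inj₂ (one e)
  ... | inj₂ q′   = inj₂ (step e q′)

  ⪯⇒path-to-new-leaf : ∀ {a b p} → b ⪯ᴳ a → Path L (inj₁ a) (inj₂ (b , p))
  ⪯⇒path-to-new-leaf (inj₁ refl) = one refl
  ⪯⇒path-to-new-leaf (inj₂ q)    = path⇒path-lxt q ++ᵖ one refl

  path-respʳ : ∀ {x y z} → x ≈⁺ y → Path L z y → Path L z x
  path-respʳ {inj₁ _} {inj₁ _} refl p = p
  path-respʳ {inj₂ _} {inj₂ _} {inj₁ _} refl p = ⪯⇒path-to-new-leaf (path-to-new-leaf⇒⪯ p)
  path-respʳ {inj₂ _} {inj₂ _} {inj₂ _} refl p = ⊥-elim (new-leaf-no-path p)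

  path-respˡ : ∀ {x y z} → x ≈⁺ y → Path L x z → Path L y z
  path-respˡ {inj₁ _} {inj₁ _} refl p = p
  path-respˡ {inj₂ _} _ p = ⊥-elim (new-leaf-no-path p)

  ⪯ᴸ-trans : ∀ {x y z} → x ⪯ᴸ y → y ⪯ᴸ z → x ⪯ᴸ z
  ⪯ᴸ-trans {x} {y} {z} (inj₁ x≈y) (inj₁ y≈z) = inj₁ (≈⁺-trans {x} {y} {z} x≈y y≈z)
  ⪯ᴸ-trans (inj₁ x≈y) (inj₂ z→y) = inj₂ (path-respʳ x≈y z→y)
  ⪯ᴸ-trans (inj₂ y→x) (inj₁ y≈z) = inj₂ (path-respˡ y≈z y→x)
  ⪯ᴸ-trans (inj₂ y→x) (inj₂ z→y) = inj₂ (z→y ++ᵖ y→x)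

  ⪯⇒⊆C : ∀ {x y} → x ⪯ᴸ y → x ⊆ y
  ⪯⇒⊆C x⪯y _ (leaf , z⪯x) = leaf , ⪯ᴸ-trans z⪯x x⪯y

  Cl-resp : ∀ {x y y′} → y ≈⁺ y′ → Cl L x y → Cl L x y′
  Cl-resp {y = y} {y′} y≈y′ (y-leaf , y⪯x) =
    (λ (u , p) → y-leaf (u , path-respˡ (≈⁺-sym {y} {y′} y≈y′) p)) ,
    ⪯ᴸ-trans (inj₁ (≈⁺-sym {y} {y′} y≈y′)) y⪯x

  leaf⇒leaf-lxt : ∀ {a} → Leaf G a → Leaf L (inj₁ a)
  leaf⇒leaf-lxt a-leaf (inj₁ b , p) = a-leaf (b , path-lxt⇒path p)
  leaf⇒leaf-lxt a-leaf (inj₂ (b , b-inner) , p) with path-to-new-leaf⇒⪯ p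
  ... | inj₁ refl = b-inner a-leaf
  ... | inj₂ q    = a-leaf (b , q)

  H : Graph
  H = HasseC L

  _⊊_ _≈ᴴ_ Eᴴ : V⁺ → V⁺ → Set
  _⊊_  = _⊊C_ L
  _≈ᴴ_ = Graph._≈_ H
  Eᴴ   = Graph.E H

  orig-⪯ᴸ⇒⪯ : ∀ {a b} → inj₁ a ⪯ᴸ inj₁ b → a ⪯ᴳ b
  orig-⪯ᴸ⇒⪯ (inj₁ a≡b) = inj₁ a≡b
  orig-⪯ᴸ⇒⪯ (inj₂ b→a) = inj₂ (path-lxt⇒path b→a)

  new-⪯ᴸ⇒⪯ : ∀ {a p b} → inj₂ (a , p) ⪯ᴸ inj₁ b → a ⪯ᴳ b
  new-⪯ᴸ⇒⪯ (inj₁ ())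
  new-⪯ᴸ⇒⪯ (inj₂ b→xa) = path-to-new-leaf⇒⪯ b→xa

  ⊆C-new⇒⪯ : ∀ {a p b} → inj₂ (a , p) ⊆ inj₁ b → a ⪯ᴳ b
  ⊆C-new⇒⪯ {a} {p} xa⊆b = new-⪯ᴸ⇒⪯ (proj₂ (xa⊆b (inj₂ (a , p)) (new-leaf-is-leaf , inj₁ refl)))

  new-≈ᴴ⇒≡ : ∀ {a p b q} → inj₂ (a , p) ≈ᴴ inj₂ (b , q) → a ≡ b
  new-≈ᴴ⇒≡ {a} {p} (xa⊆xb , _) =
    Cl-of-leaf new-leaf-is-leaf (xa⊆xb (inj₂ (a , p)) (new-leaf-is-leaf , inj₁ refl))

  ≡⇒new-≈ᴴ : ∀ {a p b q} → a ≡ b → inj₂ (a , p) ≈ᴴ inj₂ (b , q)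
  ≡⇒new-≈ᴴ a≡b = ⪯⇒⊆C (inj₁ a≡b) , ⪯⇒⊆C (inj₁ (sym a≡b))

module LeafExtendedHasse (n : ℕ) (adj : Fin n → Fin n → Bool) (acyclic : Acyclic (finGraph n adj)) where
  Edge : Fin n → Fin n → Set
  Edge u w = T (adj u w)

  open LeafExtension Edge public
  open SetoidGraph H (≈ᴴ-isEquivalence L) (Eᴴ-resp L) public

  has-child? : ∀ a → Dec (∃ (Edge a))
  has-child? a = any? λ b → T? (adj a b)

  leaf? : ∀ a → Dec (Leaf G a)
  leaf? a = map′ no-child⇒leaf (λ a-leaf (b , e) → a-leaf (b , one e)) (¬? (has-child? a))

  child : ∀ {a} → Inner G a → ∃ (Edge a)
  child {a} a-inner = decidable-stable (has-child? a) λ no-child → a-inner (no-child⇒leaf no-child)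

  ⪯⇒¬≻ : ∀ {a b} → a ⪯ᴳ b → ¬ Path G a b
  ⪯⇒¬≻ (inj₁ refl) a→a = acyclic _ a→a
  ⪯⇒¬≻ (inj₂ b→a) a→b = acyclic _ (a→b ++ᵖ b→a)

  ⪯ᴳ-antisym : ∀ {a b} → a ⪯ᴳ b → b ⪯ᴳ a → a ≡ b
  ⪯ᴳ-antisym (inj₁ a≡b) _          = a≡b
  ⪯ᴳ-antisym (inj₂ _)   (inj₁ b≡a) = sym b≡a
  ⪯ᴳ-antisym a⪯b        (inj₂ a→b) = ⊥-elim (⪯⇒¬≻ a⪯b a→b)

  cluster-nonempty : ∀ x → ∃ (Cl L x)
  cluster-nonempty (inj₂ x) = inj₂ x , new-leaf-is-leaf , inj₁ refl
  cluster-nonempty (inj₁ a) with leaf? a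
  ... | yes a-leaf = inj₁ a , leaf⇒leaf-lxt a-leaf , inj₁ refl
  ... | no a-inner = inj₂ (a , a-inner) , new-leaf-is-leaf , inj₂ (one refl)

  ⊆C-orig⇒⪯ : ∀ {a b} → inj₁ a ⊆ inj₁ b → a ⪯ᴳ b
  ⊆C-orig⇒⪯ {a} a⊆b with leaf? a
  ... | yes a-leaf = orig-⪯ᴸ⇒⪯ (proj₂ (a⊆b (inj₁ a) (leaf⇒leaf-lxt a-leaf , inj₁ refl)))
  ... | no a-inner = new-⪯ᴸ⇒⪯ (proj₂ (a⊆b (inj₂ (a , a-inner)) (new-leaf-is-leaf , inj₂ (one refl))))

  orig-≈ᴴ⇒≡ : ∀ {a b} → inj₁ a ≈ᴴ inj₁ b → a ≡ b
  orig-≈ᴴ⇒≡ (a⊆b , b⊆a) = ⪯ᴳ-antisym (⊆C-orig⇒⪯ a⊆b) (⊆C-orig⇒⪯ b⊆a)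

  ≺⇒⊊C : ∀ {a b} → Path G a b → inj₁ b ⊊ inj₁ a
  ≺⇒⊊C a→b = ⪯⇒⊆C (inj₂ (path⇒path-lxt a→b)) , λ a⊆b → ⪯⇒¬≻ (⊆C-orig⇒⪯ a⊆b) a→b

  ⊊C⇒≺ : ∀ {a b} → inj₁ b ⊊ inj₁ a → Path G a b
  ⊊C⇒≺ (b⊆a , a⊈b) with ⊆C-orig⇒⪯ b⊆a
  ... | inj₁ refl = ⊥-elim (a⊈b (⊆C-refl L))
  ... | inj₂ a→b  = a→b

  leaf⇒⊊C-minimal : ∀ {z} → Leaf L z → ∀ y → ¬ y ⊊ z
  leaf⇒⊊C-minimal {z} z-leaf y (y⊆z , z⊈y) with cluster-nonempty y
  ... | e , e∈y = z⊈y λ x x∈z → Cl-resp (e≈x x∈z) e∈y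
    where
      e≈x : ∀ {x} → Cl L z x → e ≈⁺ x
      e≈x {x} x∈z =
        ≈⁺-trans {e} {z} {x} (Cl-of-leaf z-leaf (y⊆z e e∈y)) (≈⁺-sym {x} {z} (Cl-of-leaf z-leaf x∈z))

  leaf⇒leafᴴ : ∀ {z} → Leaf L z → Leaf H z
  leaf⇒leafᴴ z-leaf (_ , p) with head-edge p
  ... | y , (y⊊z , _) = leaf⇒⊊C-minimal z-leaf y y⊊z

  new-leafᴴ : ∀ {x} → Leaf H (inj₂ x)
  new-leafᴴ = leaf⇒leafᴴ new-leaf-is-leaf

  covers⇒Eᴴ : ∀ {u w} → Covers G u w → Eᴴ (inj₁ u) (inj₁ w)
  covers⇒Eᴴ (u→w , no-between) = ≺⇒⊊C u→w , λ where
    (inj₁ b , w⊊b , b⊊u) → no-between (b , ⊊C⇒≺ w⊊b , ⊊C⇒≺ b⊊u)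
    (inj₂ _ , w⊊x , _)   → leaf⇒⊊C-minimal new-leaf-is-leaf _ w⊊x

  Eᴴ⇒covers : ∀ {u w} → Eᴴ (inj₁ u) (inj₁ w) → Covers G u w
  Eᴴ⇒covers (w⊊u , no-between) =
    ⊊C⇒≺ w⊊u , λ (b , b→w , u→b) → no-between (inj₁ b , ≺⇒⊊C b→w , ≺⇒⊊C u→b)

  -- A child b of a has a leaf below it, which is not x_a: x_a lies below b only if a ⪯ b.
  orig-⊈C-new : ∀ {a} (a-inner : Inner G a) → ¬ inj₁ a ⊆ inj₂ (a , a-inner)
  orig-⊈C-new {a} a-inner a⊆xa with child a-inner
  ... | b , a→b with cluster-nonempty (inj₁ b)
  ...   | e , e∈b = ⪯⇒¬≻ (new-⪯ᴸ⇒⪯ xa⪯b) (one a→b)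
    where
      e≈xa : e ≈⁺ inj₂ (a , a-inner)
      e≈xa = Cl-of-leaf new-leaf-is-leaf (a⊆xa e (⪯⇒⊆C (inj₂ (one a→b)) e e∈b))
      xa⪯b : inj₂ (a , a-inner) ⪯ᴸ inj₁ b
      xa⪯b = ⪯ᴸ-trans (inj₁ (≈⁺-sym {e} e≈xa)) (proj₂ e∈b)

  Eᴴ-new-leaf : ∀ {a} (a-inner : Inner G a) → Eᴴ (inj₁ a) (inj₂ (a , a-inner))
  Eᴴ-new-leaf a-inner = (⪯⇒⊆C (inj₂ (one refl)) , orig-⊈C-new a-inner) , λ where
    (inj₁ _ , (xa⊆b , _) , (b⊆a , a⊈b)) →
      a⊈b (⪯⇒⊆C (inj₁ (⪯ᴳ-antisym (⊆C-new⇒⪯ xa⊆b) (⊆C-orig⇒⪯ b⊆a))))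
    (inj₂ _ , xa⊊x , _) → leaf⇒⊊C-minimal new-leaf-is-leaf _ xa⊊x

  Eᴴ-into-new-leaf : ∀ {w v p} → Eᴴ w (inj₂ (v , p)) → w ≈ᴴ inj₁ v
  Eᴴ-into-new-leaf {inj₂ _} (xv⊊x , _) = ⊥-elim (leaf⇒⊊C-minimal new-leaf-is-leaf _ xv⊊x)
  Eᴴ-into-new-leaf {inj₁ b} {v} {p} ((xv⊆b , _) , no-between) with ⊆C-new⇒⪯ xv⊆b
  ... | inj₁ refl = ≈ᴴ-refl L
  ... | inj₂ b→v  = ⊥-elim (no-between (inj₁ v , proj₁ (Eᴴ-new-leaf p) , ≺⇒⊊C b→v))

  inner⇒innerᴴ : ∀ {a} → Inner G a → Inner H (inj₁ a)
  inner⇒innerᴴ a-inner a-leafᴴ = a-leafᴴ (_ , one (Eᴴ-new-leaf a-inner))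

  innerᴴ⇒inner : ∀ {a} → Inner H (inj₁ a) → Inner G a
  innerᴴ⇒inner a-innerᴴ a-leaf = a-innerᴴ (leaf⇒leafᴴ (leaf⇒leaf-lxt a-leaf))

  orig-≉ᴴ-new : ∀ {a b q} → ¬ inj₁ a ≈ᴴ inj₂ (b , q)
  orig-≉ᴴ-new {a} a≈xb with leaf? a
  ... | yes a-leaf = Cl-of-leaf new-leaf-is-leaf (proj₁ a≈xb (inj₁ a) (leaf⇒leaf-lxt a-leaf , inj₁ refl))
  ... | no a-inner = Leaf-resp (≈ᴴ-sym L a≈xb) new-leafᴴ (_ , one (Eᴴ-new-leaf a-inner))

  _≈ᴴ?_ : ∀ x y → Dec (x ≈ᴴ y)
  inj₁ a ≈ᴴ? inj₁ b             = map′ (λ { refl → ≈ᴴ-refl L }) orig-≈ᴴ⇒≡ (a ≟ b)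
  inj₂ (a , _) ≈ᴴ? inj₂ (b , _) = map′ ≡⇒new-≈ᴴ new-≈ᴴ⇒≡ (a ≟ b)
  inj₁ _ ≈ᴴ? inj₂ _             = no orig-≉ᴴ-new
  inj₂ _ ≈ᴴ? inj₁ _             = no λ xa≈b → orig-≉ᴴ-new (≈ᴴ-sym L xa≈b)

  new-leaf : (v : V⁺) → Inner H v → V⁺
  new-leaf (inj₁ a) a-innerᴴ = inj₂ (a , innerᴴ⇒inner a-innerᴴ)
  new-leaf (inj₂ _) x-innerᴴ = ⊥-elim (x-innerᴴ new-leafᴴ)

  new-leaf-choice : LopChoice H
  new-leaf-choice = record
    { ch = new-leaf ; ch-child = child-edge ; ch-leaf = leaf ; ch-indeg = indeg ; ch-resp = resp }
    where
      child-edge : ∀ v i → Eᴴ v (new-leaf v i)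
      child-edge (inj₁ _) _        = Eᴴ-new-leaf _
      child-edge (inj₂ _) x-innerᴴ = ⊥-elim (x-innerᴴ new-leafᴴ)

      leaf : ∀ v i → Leaf H (new-leaf v i)
      leaf (inj₁ _) _        = new-leafᴴ
      leaf (inj₂ _) x-innerᴴ = ⊥-elim (x-innerᴴ new-leafᴴ)

      indeg : ∀ v i → InDegOne H (new-leaf v i)
      indeg (inj₁ a) _        = inj₁ a , Eᴴ-new-leaf _ , λ _ → Eᴴ-into-new-leaf
      indeg (inj₂ _) x-innerᴴ = ⊥-elim (x-innerᴴ new-leafᴴ)

      resp : ∀ v v′ i i′ → v ≈ᴴ v′ → new-leaf v i ≈ᴴ new-leaf v′ i′
      resp (inj₁ _) (inj₁ _) _ _ a≈a′   = ≡⇒new-≈ᴴ (orig-≈ᴴ⇒≡ a≈a′)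
      resp (inj₁ _) (inj₂ _) _ x-innerᴴ _ = ⊥-elim (x-innerᴴ new-leafᴴ)
      resp (inj₂ _) _ x-innerᴴ _ _       = ⊥-elim (x-innerᴴ new-leafᴴ)

  sf≃lop-new-leaves : sf G ≃ lop H new-leaf-choice
  sf≃lop-new-leaves = record
    { f     = λ u → inj₁ u , orig-unchosen
    ; resp  = λ { refl → ≈ᴴ-refl L }
    ; inj   = orig-≈ᴴ⇒≡
    ; surj  = surj
    ; edge→ = λ e → covers⇒Eᴴ (sf-edge⇒covers G e)
    ; edge← = λ e → covers⇒sf-edge G (Eᴴ⇒covers e)
    }
    where
      orig-unchosen : ∀ {u} → ¬ Chosen new-leaf-choice (inj₁ u)
      orig-unchosen (inj₁ _ , _ , u≈xa)    = orig-≉ᴴ-new u≈xa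
      orig-unchosen (inj₂ _ , x-innerᴴ , _) = x-innerᴴ new-leafᴴ

      surj : ∀ y → ∃ λ u → inj₁ u ≈ᴴ proj₁ y
      surj (inj₁ a , _) = a , ≈ᴴ-refl L
      surj (inj₂ (b , b-inner) , xb-unchosen) =
        ⊥-elim (xb-unchosen (inj₁ b , inner⇒innerᴴ b-inner , ≡⇒new-≈ᴴ refl))

  chosen? : ∀ c w → Dec (Chosen c w)
  chosen? c w = map′ (λ (a , i , w≈) → inj₁ a , i , w≈) from-chosen (any? chosen-at?)
    where
      open LopChoice c

      chosen-at? : ∀ a → Dec (Σ (Inner H (inj₁ a)) λ i → w ≈ᴴ ch (inj₁ a) i)
      chosen-at? a with leaf? a
      ... | yes a-leaf = no λ (a-innerᴴ , _) → innerᴴ⇒inner a-innerᴴ a-leaf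
      ... | no a-inner =
        map′ (inner⇒innerᴴ a-inner ,_)
             (λ (i , w≈) → ≈ᴴ-trans L w≈ (ch-resp _ _ i _ (≈ᴴ-refl L)))
             (w ≈ᴴ? ch (inj₁ a) (inner⇒innerᴴ a-inner))

      from-chosen : Chosen c w → ∃ λ a → Σ (Inner H (inj₁ a)) λ i → w ≈ᴴ ch (inj₁ a) i
      from-chosen (inj₁ a , i , w≈)         = a , i , w≈
      from-chosen (inj₂ _ , x-innerᴴ , _) = ⊥-elim (x-innerᴴ new-leafᴴ)

proposition8p3 : (n : ℕ) (adj : Fin n → Fin n → Bool) →
    Acyclic (finGraph n adj) →
    LopChoice (HasseC (lxt (finGraph n adj))) ×
    ((c : LopChoice (HasseC (lxt (finGraph n adj)))) →
    sf (finGraph n adj) ≃ lop (HasseC (lxt (finGraph n adj))) c)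
proposition8p3 n adj acyclic =
  new-leaf-choice ,
  λ c → ≃-trans (≈ᴴ-trans L) sf≃lop-new-leaves (lop-unique chosen? new-leaf-choice c)
  where
    open LeafExtendedHasse n adj acyclic
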